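{- Let $K$ be a finite simplicial complex and $s\ge1$. The set $L^s(K)$, partially ordered by inclusion, is a finite lattice with least element $\emptyset$, greatest element $F^s(K)$, and meet $S\wedge T=S\cap T$.
   Context: $F^s(K)$ is the set of $s$-simplices (faces with $s+1$ vertices) of $K$. For $S\subseteq F^s(K)$, its connected components are the equivalence classes of the smallest equivalence relation on $S$ relating any two simplices with nonempty intersection; $V(S)=\bigcup S$; $S$ is closed if $\{\sigma\in F^s(K)\mid\sigma\subseteq V(S)\}=S$. $L^s(K)$ (the $s$-chromatic lattice) is the set of all subsets of $F^s(K)$ all of whose connected components are closed. -}

module Defs where

open import Data.Nat using (ℕ; suc; _≡ᵇ_)
open import Data.Bool using (Bool; true; false; _∧_)
open import Data.Fin using (Fin)
open import Data.Fin.Subset using (Subset; _∈_; _⊆_; _∩_; ∣_∣; Nonempty)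
open import Data.Product using (Σ; ∃; _×_)
open import Relation.Binary.PropositionalEquality using (_≡_)
open import Relation.Binary.Construct.Closure.ReflexiveTransitive using (Star)

-- Vertices are Fin n (so every complex is finite); a simplex (face) is a
-- subset of the vertex set.
Simplex : ℕ → Set
Simplex n = Subset n

record SimplicialComplex (n : ℕ) : Set where
  field
    face        : Simplex n → Bool
    down-closed : ∀ (σ τ : Simplex n) → τ ⊆ σ → face σ ≡ true → face τ ≡ true
open SimplicialComplex public

Family : ℕ → Set
Family n = Simplex n → Bool

_∈F_ : ∀ {n} → Simplex n → Family n → Set
σ ∈F S = S σ ≡ true

_⊆F_ : ∀ {n} → Family n → Family n → Set
S ⊆F T = ∀ σ → σ ∈F S → σ ∈F T

_≐F_ : ∀ {n} → Family n → Family n → Set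
S ≐F T = (S ⊆F T) × (T ⊆F S)

∅F : ∀ {n} → Family n
∅F _ = false

_∩F_ : ∀ {n} → Family n → Family n → Family n
(S ∩F T) σ = S σ ∧ T σ

F : ∀ {n} → ℕ → SimplicialComplex n → Family n
F s K σ = face K σ ∧ (∣ σ ∣ ≡ᵇ suc s)

Adj : ∀ {n} → Family n → Simplex n → Simplex n → Set
Adj S σ τ = σ ∈F S × τ ∈F S × Nonempty (σ ∩ τ)

-- The connected component of σ in S (for σ ∈ S): all τ ∈ S related to σ by
-- the reflexive-transitive closure of Adj S (which, restricted to S, is the
-- smallest equivalence relation containing the intersection relation).
InComponent : ∀ {n} → Family n → Simplex n → Simplex n → Set
InComponent S σ τ = τ ∈F S × Star (Adj S) σ τ

InV : ∀ {n} → (Simplex n → Set) → Fin n → Set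
InV C x = ∃ λ σ → C σ × x ∈ σ

Closed : ∀ {n} → ℕ → SimplicialComplex n → (Simplex n → Set) → Set
Closed {n} s K C =
  ∀ (σ : Simplex n) → ((σ ∈F F s K) × (∀ x → x ∈ σ → InV C x) → C σ)
                    × (C σ → (σ ∈F F s K) × (∀ x → x ∈ σ → InV C x))

InL : ∀ {n} → ℕ → SimplicialComplex n → Family n → Set
InL s K S = (S ⊆F F s K) × (∀ σ → σ ∈F S → Closed s K (InComponent S σ))

-- A set S of s-simplices lies in L^s(K) iff each of its components contains every
-- s-simplex whose vertices it covers.  This property is inherited by intersections,
-- which gives the meet.  For the join of S and T, connect two vertices when they lie
-- in a common simplex of S ∪ T; the join consists of the s-simplices whose vertices
-- all lie in a single connected class of this vertex graph.  Membership in it is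
-- decidable because reachability in a finite graph is found by breadth-first search,
-- which stabilises after as many rounds as there are vertices, since the explored
-- set grows in every round until it is closed.
module Submission where

open import Defs
open import Level using (Level; 0ℓ)
open import Data.Nat using (ℕ; _≥_; zero; suc; _≤_; s≤s)
open import Data.Nat.Properties using (≡ᵇ⇒≡; ≤-trans; ≤-reflexive; <-irrefl; 0≢1+n)
open import Data.Bool using (true; false; _∧_; _∨_; _≟_)
open import Data.Bool.Properties using (∧-conicalˡ; ∧-conicalʳ; ∨-zeroʳ; T-≡)
open import Data.Sum using (_⊎_; inj₁; inj₂)
open import Data.Product using (Σ; ∃; _×_; _,_; proj₁; proj₂)
open import Data.Fin using (Fin)
open import Data.Fin.Properties using (any?; all?)
open import Data.Fin.Subset using (Subset; _∈_; _⊆_; _⊂_; _∩_; ∣_∣; Nonempty; ⁅_⁆)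
open import Data.Fin.Subset.Properties
  using (_∈?_; nonempty?; Empty-unique; ∣⊥∣≡0; ∣⁅x⁆∣≡1; x∈⁅x⁆; x∈⁅y⁆⇒x≡y;
         p⊂q⇒∣p∣<∣q∣; ∣p∣≤n; x∈p∩q⁺; x∈p∩q⁻; anySubset?)
open import Data.Vec using (tabulate)
open import Data.Vec.Properties using ([]=⇒lookup; lookup⇒[]=; lookup∘tabulate)
open import Function using (_∘_; id; Equivalence)
open import Relation.Nullary using (Dec; yes; no; does; ¬?; contradiction)
open import Relation.Nullary.Decidable using (_×-dec_; _⊎-dec_; _→-dec_; map′; dec-true)
open import Relation.Unary using (Pred)
import Relation.Unary as U
open import Relation.Binary using (Rel; Decidable)
open import Relation.Binary.PropositionalEquality using (_≡_; refl; sym; trans; cong; cong₂)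
open import Relation.Binary.Construct.Closure.ReflexiveTransitive
  using (Star; ε; _◅_; _◅◅_; fold; reverse) renaming (map to mapStar)

private
  variable
    a q r ℓ : Level
    A : Set a

Star-transport : {R : Rel A r} (Q : Pred A q) → (∀ {x y} → R x y → Q x → Q y) →
                 ∀ {x y} → Star R x y → Q x → Q y
Star-transport Q step = fold (λ x y → Q x → Q y) (λ r f → f ∘ step r) id

dec-true⁻ : (a? : Dec A) → does a? ≡ true → A
dec-true⁻ (yes a) _  = a
dec-true⁻ (no _)  ()

comprehension : ∀ {n} {P : Pred (Fin n) ℓ} → U.Decidable P → Subset n
comprehension P? = tabulate (does ∘ P?)

module _ {n} {P : Pred (Fin n) ℓ} (P? : U.Decidable P) where

  ∈-comprehension⁺ : ∀ {x} → P x → x ∈ comprehension P?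
  ∈-comprehension⁺ {x} p =
    lookup⇒[]= x _ (trans (lookup∘tabulate (does ∘ P?) x) (dec-true (P? x) p))

  ∈-comprehension⁻ : ∀ {x} → x ∈ comprehension P? → P x
  ∈-comprehension⁻ {x} x∈ =
    dec-true⁻ (P? x) (trans (sym (lookup∘tabulate (does ∘ P?) x)) ([]=⇒lookup x∈))

module Reachability {n} {E : Rel (Fin n) ℓ} (E? : Decidable E) where

  ForwardClosed : Subset n → Set ℓ
  ForwardClosed W = ∀ {z y} → z ∈ W → E z y → y ∈ W

  ReachedFrom : Subset n → Pred (Fin n) ℓ
  ReachedFrom W y = y ∈ W ⊎ ∃ λ z → z ∈ W × E z y

  reachedFrom? : ∀ W → U.Decidable (ReachedFrom W)
  reachedFrom? W y = (y ∈? W) ⊎-dec any? λ z → (z ∈? W) ×-dec E? z y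

  expand : Subset n → Subset n
  expand W = comprehension (reachedFrom? W)

  ∈-expand⁺ : ∀ {W y} → ReachedFrom W y → y ∈ expand W
  ∈-expand⁺ {W} = ∈-comprehension⁺ (reachedFrom? W)

  ∈-expand⁻ : ∀ {W y} → y ∈ expand W → ReachedFrom W y
  ∈-expand⁻ {W} = ∈-comprehension⁻ (reachedFrom? W)

  ⊆-expand : ∀ W → W ⊆ expand W
  ⊆-expand W = ∈-expand⁺ ∘ inj₁

  expand-forward : ∀ {W z y} → z ∈ W → E z y → y ∈ expand W
  expand-forward z∈W e = ∈-expand⁺ (inj₂ (_ , z∈W , e))

  expand-closed : ∀ {W} → ForwardClosed W → ForwardClosed (expand W)
  expand-closed {W} closed z∈ e = ⊆-expand W (closed (shrink z∈) e)
    where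
    shrink : expand W ⊆ W
    shrink y∈ with ∈-expand⁻ y∈
    ... | inj₁ y∈W             = y∈W
    ... | inj₂ (_ , z∈W , e′) = closed z∈W e′

  closed-or-⊂-expand : ∀ W → ForwardClosed W ⊎ W ⊂ expand W
  closed-or-⊂-expand W
    with any? (λ z → any? λ y → (z ∈? W) ×-dec E? z y ×-dec ¬? (y ∈? W))
  ... | yes (_ , y , z∈W , e , y∉W) = inj₂ (⊆-expand W , y , expand-forward z∈W e , y∉W)
  ... | no ¬escape = inj₁ closed
    where
    closed : ForwardClosed W
    closed {z} {y} z∈W e with y ∈? W
    ... | yes y∈W = y∈W
    ... | no y∉W  = contradiction (z , y , z∈W , e , y∉W) ¬escape

  reachableIn : ℕ → Fin n → Subset n
  reachableIn zero    x = ⁅ x ⁆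
  reachableIn (suc k) x = expand (reachableIn k x)

  reachable : Fin n → Subset n
  reachable = reachableIn n

  closed-or-large : ∀ k x → ForwardClosed (reachableIn k x) ⊎ suc k ≤ ∣ reachableIn k x ∣
  closed-or-large zero x = inj₂ (≤-reflexive (sym (∣⁅x⁆∣≡1 x)))
  closed-or-large (suc k) x with closed-or-large k x | closed-or-⊂-expand (reachableIn k x)
  ... | inj₁ closed | _           = inj₁ (expand-closed closed)
  ... | inj₂ _      | inj₁ closed = inj₁ (expand-closed closed)
  ... | inj₂ large  | inj₂ grows  = inj₂ (≤-trans (s≤s large) (p⊂q⇒∣p∣<∣q∣ grows))

  reachable-closed : ∀ x → ForwardClosed (reachable x)
  reachable-closed x with closed-or-large n x
  ... | inj₁ closed = closed
  ... | inj₂ large  = contradiction (≤-trans large (∣p∣≤n (reachable x))) (<-irrefl refl)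

  x∈reachableIn : ∀ k x → x ∈ reachableIn k x
  x∈reachableIn zero    x = x∈⁅x⁆ x
  x∈reachableIn (suc k) x = ⊆-expand _ (x∈reachableIn k x)

  reachableIn-sound : ∀ k {x y} → y ∈ reachableIn k x → Star E x y
  reachableIn-sound zero {x} y∈ with x∈⁅y⁆⇒x≡y x y∈
  ... | refl = ε
  reachableIn-sound (suc k) y∈ with ∈-expand⁻ y∈
  ... | inj₁ y∈R            = reachableIn-sound k y∈R
  ... | inj₂ (_ , z∈R , e) = reachableIn-sound k z∈R ◅◅ e ◅ ε

  reachable-complete : ∀ {x y} → Star E x y → y ∈ reachable x
  reachable-complete {x} path =
    Star-transport (_∈ reachable x) (λ e z∈ → reachable-closed x z∈ e) path (x∈reachableIn n x)

  Star? : Decidable (Star E)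
  Star? x y = map′ (reachableIn-sound n) reachable-complete (y ∈? reachable x)

module _ {n} {S T : Family n} where

  ∩F-⊆ˡ : (S ∩F T) ⊆F S
  ∩F-⊆ˡ σ = ∧-conicalˡ (S σ) (T σ)

  ∩F-⊆ʳ : (S ∩F T) ⊆F T
  ∩F-⊆ʳ σ = ∧-conicalʳ (S σ) (T σ)

  ∩F-greatest : ∀ {U} → U ⊆F S → U ⊆F T → U ⊆F (S ∩F T)
  ∩F-greatest U⊆S U⊆T σ σ∈U = cong₂ _∧_ (U⊆S σ σ∈U) (U⊆T σ σ∈U)

_∪F_ : ∀ {n} → Family n → Family n → Family n
(S ∪F T) σ = S σ ∨ T σ

module _ {n} {S T : Family n} where

  ∪F-⊇ˡ : S ⊆F (S ∪F T)
  ∪F-⊇ˡ σ σ∈S = cong (_∨ T σ) σ∈S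

  ∪F-⊇ʳ : T ⊆F (S ∪F T)
  ∪F-⊇ʳ σ σ∈T = trans (cong (S σ ∨_) σ∈T) (∨-zeroʳ (S σ))

  ∪F-least : ∀ {U} → S ⊆F U → T ⊆F U → (S ∪F T) ⊆F U
  ∪F-least S⊆U T⊆U σ σ∈S∪T with S σ in σ∈S
  ... | true  = S⊆U σ σ∈S
  ... | false = T⊆U σ σ∈S∪T

F-nonempty : ∀ {n} s (K : SimplicialComplex n) {σ} → σ ∈F F s K → Nonempty σ
F-nonempty {n} s K {σ} σ∈F with nonempty? σ
... | yes nonempty = nonempty
... | no empty     = contradiction (trans (sym ∣σ∣≡0) ∣σ∣≡1+s) 0≢1+n
  where
  ∣σ∣≡0 : ∣ σ ∣ ≡ 0
  ∣σ∣≡0 = trans (cong ∣_∣ (Empty-unique empty)) (∣⊥∣≡0 n)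
  ∣σ∣≡1+s : ∣ σ ∣ ≡ suc s
  ∣σ∣≡1+s = ≡ᵇ⇒≡ ∣ σ ∣ (suc s) (Equivalence.from T-≡ (∧-conicalʳ (face K σ) _ σ∈F))

Covers : ∀ {n} → (Simplex n → Set) → Simplex n → Set
Covers C τ = ∀ x → x ∈ τ → InV C x

module _ {n} {S : Family n} where

  InComponent-extend : ∀ {σ ρ τ x} → InComponent S σ ρ → τ ∈F S → x ∈ ρ → x ∈ τ →
                       InComponent S σ τ
  InComponent-extend (ρ∈S , path) τ∈S x∈ρ x∈τ =
    τ∈S , path ◅◅ (ρ∈S , τ∈S , _ , x∈p∩q⁺ (x∈ρ , x∈τ)) ◅ ε

  Covers-InComponent-mono : ∀ {T σ τ} → S ⊆F T →
                            Covers (InComponent S σ) τ → Covers (InComponent T σ) τ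
  Covers-InComponent-mono S⊆T cover x x∈τ with cover x x∈τ
  ... | ρ , (ρ∈S , path) , x∈ρ =
    ρ , (S⊆T ρ ρ∈S , mapStar (λ (σ∈S , τ∈S , meet) → S⊆T _ σ∈S , S⊆T _ τ∈S , meet) path) , x∈ρ

-- By InComponent-extend, this is all that Closed asks beyond S ⊆ F^s(K).
Saturated : ∀ {n} → ℕ → SimplicialComplex n → Family n → Set
Saturated s K S = ∀ {σ τ} → σ ∈F S → τ ∈F F s K → Covers (InComponent S σ) τ → τ ∈F S

module _ {n} (s : ℕ) (K : SimplicialComplex n) where

  saturated⇒InL : ∀ {S} → S ⊆F F s K → Saturated s K S → InL s K S
  saturated⇒InL S⊆F saturated = S⊆F , λ σ σ∈S τ →
      (λ (τ∈F , cover) →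
         let (x , x∈τ)        = F-nonempty s K τ∈F
             (ρ , ρ∈C , x∈ρ) = cover x x∈τ
         in InComponent-extend ρ∈C (saturated σ∈S τ∈F cover) x∈ρ x∈τ)
    , λ τ∈C → S⊆F τ (proj₁ τ∈C) , λ x x∈τ → τ , τ∈C , x∈τ

  InL⇒saturated : ∀ {S} → InL s K S → Saturated s K S
  InL⇒saturated (_ , closed) σ∈S τ∈F cover = proj₁ (proj₁ (closed _ σ∈S _) (τ∈F , cover))

  ∅F-InL : InL s K ∅F
  ∅F-InL = saturated⇒InL (λ _ ()) (λ ())

  F-InL : InL s K (F s K)
  F-InL = saturated⇒InL (λ _ → id) (λ _ τ∈F _ → τ∈F)

  ∩F-InL : ∀ {S T} → InL s K S → InL s K T → InL s K (S ∩F T)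
  ∩F-InL {S} {T} LS LT = saturated⇒InL (λ σ → proj₁ LS σ ∘ S∩T⊆S σ) saturated
    where
    S∩T⊆S : (S ∩F T) ⊆F S
    S∩T⊆S = ∩F-⊆ˡ
    S∩T⊆T : (S ∩F T) ⊆F T
    S∩T⊆T = ∩F-⊆ʳ
    saturated : Saturated s K (S ∩F T)
    saturated σ∈ τ∈F cover = cong₂ _∧_
      (InL⇒saturated LS (S∩T⊆S _ σ∈) τ∈F (Covers-InComponent-mono S∩T⊆S cover))
      (InL⇒saturated LT (S∩T⊆T _ σ∈) τ∈F (Covers-InComponent-mono S∩T⊆T cover))

module Join {n} (s : ℕ) (K : SimplicialComplex n) (P : Family n) where

  Linked : Rel (Fin n) 0ℓ
  Linked x y = ∃ λ ρ → ρ ∈F P × x ∈ ρ × y ∈ ρ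

  linked? : Decidable Linked
  linked? x y = anySubset? λ ρ → (P ρ ≟ true) ×-dec (x ∈? ρ) ×-dec (y ∈? ρ)

  Linked-sym : ∀ {x y} → Linked x y → Linked y x
  Linked-sym (ρ , ρ∈P , x∈ρ , y∈ρ) = ρ , ρ∈P , y∈ρ , x∈ρ

  open Reachability linked? using (Star?)

  -- Linked x x says that x is a vertex of P.
  Spanned : Simplex n → Set
  Spanned σ = (∀ x → x ∈ σ → Linked x x) × (∀ x y → x ∈ σ → y ∈ σ → Star Linked x y)

  spanned? : U.Decidable Spanned
  spanned? σ = all? (λ x → (x ∈? σ) →-dec linked? x x)
         ×-dec all? (λ x → all? λ y → (x ∈? σ) →-dec (y ∈? σ) →-dec Star? x y)

  join : Family n
  join σ = F s K σ ∧ does (spanned? σ)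

  ∈join⁺ : ∀ {σ} → σ ∈F F s K → Spanned σ → σ ∈F join
  ∈join⁺ {σ} σ∈F spanned = cong₂ _∧_ σ∈F (dec-true (spanned? σ) spanned)

  ∈join⁻ : ∀ {σ} → σ ∈F join → σ ∈F F s K × Spanned σ
  ∈join⁻ {σ} σ∈ = ∧-conicalˡ (F s K σ) _ σ∈
                , dec-true⁻ (spanned? σ) (∧-conicalʳ (F s K σ) _ σ∈)

  ⊆join : ∀ {S} → S ⊆F F s K → S ⊆F P → S ⊆F join
  ⊆join S⊆F S⊆P σ σ∈S = ∈join⁺ (S⊆F σ σ∈S)
    ( (λ x x∈σ → σ , S⊆P σ σ∈S , x∈σ , x∈σ)
    , (λ x y x∈σ y∈σ → (σ , S⊆P σ σ∈S , x∈σ , y∈σ) ◅ ε))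

  join-component-linked : ∀ {σ ρ a b} → σ ∈F join → Star (Adj join) σ ρ →
                          a ∈ σ → b ∈ ρ → Star Linked a b
  join-component-linked σ∈ ε a∈σ b∈σ = proj₂ (proj₂ (∈join⁻ σ∈)) _ _ a∈σ b∈σ
  join-component-linked {σ} σ∈ ((_ , σ′∈ , _ , z∈σ∩σ′) ◅ path) a∈σ b∈ρ =
    let (z∈σ , z∈σ′) = x∈p∩q⁻ σ _ z∈σ∩σ′
    in proj₂ (proj₂ (∈join⁻ σ∈)) _ _ a∈σ z∈σ ◅◅ join-component-linked σ′∈ path z∈σ′ b∈ρ

  join-saturated : Saturated s K join
  join-saturated {σ} {τ} σ∈ τ∈F cover = ∈join⁺ τ∈F (in-P , connected)
    where
    base : Nonempty σ
    base = F-nonempty s K (proj₁ (∈join⁻ σ∈))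
    in-P : ∀ x → x ∈ τ → Linked x x
    in-P x x∈τ with cover x x∈τ
    ... | ρ , (ρ∈ , _) , x∈ρ = proj₁ (proj₂ (∈join⁻ ρ∈)) x x∈ρ
    from-base : ∀ x → x ∈ τ → Star Linked (proj₁ base) x
    from-base x x∈τ with cover x x∈τ
    ... | _ , (_ , path) , x∈ρ = join-component-linked σ∈ path (proj₂ base) x∈ρ
    connected : ∀ x y → x ∈ τ → y ∈ τ → Star Linked x y
    connected x y x∈τ y∈τ = reverse Linked-sym (from-base x x∈τ) ◅◅ from-base y y∈τ

  join-InL : InL s K join
  join-InL = saturated⇒InL s K (λ _ → proj₁ ∘ ∈join⁻) join-saturated

  Linked-preserves-InV : ∀ {U ρ z w} → P ⊆F U → Linked z w →
                         InV (InComponent U ρ) z → InV (InComponent U ρ) w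
  Linked-preserves-InV P⊆U (ρ′ , ρ′∈P , z∈ρ′ , w∈ρ′) (τ , τ∈C , z∈τ) =
    ρ′ , InComponent-extend τ∈C (P⊆U _ ρ′∈P) z∈τ z∈ρ′ , w∈ρ′

  join-least : ∀ {U} → InL s K U → P ⊆F U → join ⊆F U
  join-least {U} LU P⊆U σ σ∈ =
    let (σ∈F , in-P , connected) = ∈join⁻ σ∈
        (x , x∈σ)               = F-nonempty s K σ∈F
        (ρ , ρ∈P , x∈ρ , _)     = in-P x x∈σ
        ρ∈U                     = P⊆U ρ ρ∈P
    in InL⇒saturated s K LU ρ∈U σ∈F λ y y∈σ →
         Star-transport (InV (InComponent U ρ)) (Linked-preserves-InV P⊆U)
                        (connected x y x∈σ y∈σ) (ρ , (ρ∈U , ε) , x∈ρ)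

corollary2p17 : ∀ (n : ℕ) (K : SimplicialComplex n) (s : ℕ) → s ≥ 1 →
      (InL s K ∅F × (∀ S → InL s K S → ∅F ⊆F S))
    × (InL s K (F s K) × (∀ S → InL s K S → S ⊆F F s K))
    × (∀ S T → InL s K S → InL s K T →
         InL s K (S ∩F T) × (S ∩F T) ⊆F S × (S ∩F T) ⊆F T
         × (∀ U → InL s K U → U ⊆F S → U ⊆F T → U ⊆F (S ∩F T)))
    × (∀ S T → InL s K S → InL s K T →
         Σ (Family n) λ J → InL s K J × S ⊆F J × T ⊆F J
           × (∀ U → InL s K U → S ⊆F U → T ⊆F U → J ⊆F U))
corollary2p17 n K s _ =
    (∅F-InL s K , λ _ _ _ ())
  , (F-InL s K , λ _ → proj₁)
  , (λ S T LS LT → ∩F-InL s K LS LT , ∩F-⊆ˡ , ∩F-⊆ʳ , λ _ _ → ∩F-greatest)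
  , λ S T LS LT → let open Join s K (S ∪F T) in
      join , join-InL , ⊆join (proj₁ LS) ∪F-⊇ˡ , ⊆join (proj₁ LT) ∪F-⊇ʳ
           , λ _ LU S⊆U T⊆U → join-least LU (∪F-least S⊆U T⊆U)
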